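{- For every integer $N\geq1$, $2^{\omega(N)} \leq 4.862\, N^{1/4}$ and $\nu(N) \leq 21.234\, N^{1/16}$.
   Context: $\omega(N)$ is the number of distinct prime divisors of $N$, and $\nu(N)=\prod_{p\mid N}\nu_p$ where $\nu_2=4$ and $\nu_p=1+\frac{2}{p-2}$ for odd primes $p$. -}

module Defs where

open import Data.Nat as ℕ using (ℕ; zero; suc; _∸_)
open import Data.Nat.Divisibility using (_∣_; _∣?_)
open import Data.Nat.Primality using (Prime; prime?)
open import Data.List using (List; filter; upTo; length; foldr)
open import Data.Product using (_×_)
open import Relation.Nullary.Decidable using (_×-dec_)
open import Data.Integer using (+_)
open import Data.Rational using (ℚ; _/_; _*_; 1ℚ)

-- The list of distinct prime divisors of N (each prime divisor p satisfies p ≤ N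
-- when N ≥ 1, so it suffices to search 0,1,...,N).
primeDivisors : ℕ → List ℕ
primeDivisors N = filter (λ p → prime? p ×-dec (p ∣? N)) (upTo (suc N))

ω : ℕ → ℕ
ω N = length (primeDivisors N)

-- ν_p : ν_2 = 4, and ν_p = 1 + 2/(p-2) = p/(p-2) for odd primes p.
-- (Only ever applied to primes; the value at p ∈ {0,1} is irrelevant.)
νₚ : ℕ → ℚ
νₚ 0 = 1ℚ
νₚ 1 = 1ℚ
νₚ 2 = + 4 / 1
νₚ (suc (suc (suc k))) = + (3 ℕ.+ k) / suc k   -- p = k+3, p - 2 = k+1

ν : ℕ → ℚ
ν N = foldr (λ p acc → νₚ p * acc) 1ℚ (primeDivisors N)

_^ℚ_ : ℚ → ℕ → ℚ
q ^ℚ zero = 1ℚ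
q ^ℚ suc n = q * (q ^ℚ n)

-- Compare ∏_{p ∣ N} h(p)^k / p with ∏_{p < t, p prime} max(1, h(p)^k / p). Every factor of the
-- second product is at least 1, so it dominates the first one as soon as the primes p ≥ t, for
-- which h(p)^k ≤ p, are discarded; and ∏_{p ∣ N} p ≤ N. Hence (∏_{p ∣ N} h(p))^k ≤ C^k N with
-- C^k = ∏_{p < t} max(1, h(p)^k / p), a finite computation. For 2^ω take h = 2 and k = 4, for ν
-- take h = νₚ and k = 16, with t = 17 in both cases; νₚ^16 ≤ p for p ≥ 17 because
-- (p / (p - 2))^15 / (p - 2) decreases in p.
module Submission where

open import Defs
open import Data.Nat as ℕ using (ℕ; _≥_; _^_)
open import Data.Integer using (+_)
open import Data.Rational as ℚ using (ℚ; _/_)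
open import Data.Product using (_×_)

open import Level using (Level)
open import Function using (_∘_; id)
open import Data.Empty using (⊥-elim)
open import Data.Product using (_,_; proj₁; proj₂)
open import Data.Sum using (inj₁; inj₂)
open import Data.Nat using (zero; suc; pred; _+_; _*_; _⊔_; _⊔′_; NonZero; >-nonZero)
open import Data.Nat using (_≤_; z≤n; s≤s; _≤′_; ≤′-refl; ≤′-step)
open import Data.Nat.Properties
open import Data.Nat.Divisibility using (_∣_; _∣?_; divides; ∣⇒≤; ∣1⇒≡1; 1∣_)
open import Data.Nat.ListAction using (product)
open import Data.Nat.ListAction.Properties using (product-++; product≢0)
open import Data.Nat.Primality
  using (Prime; prime?; euclidsLemma; prime⇒irreducible; prime⇒nonZero; ¬prime[1])
open import Data.Nat.Tactic.RingSolver using (solve-∀)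
open import Data.List using (List; []; _∷_; _++_; map; filter; upTo; applyUpTo; length; foldr)
open import Data.List.Properties using (map-++; filter-++; map-cong-local; map-id)
open import Data.List.Membership.Propositional using (_∈_)
open import Data.List.Relation.Unary.Any using (here; there)
open import Data.List.Relation.Unary.All as All using (All; []; _∷_)
open import Data.List.Relation.Unary.All.Properties as All using (all-filter; applyUpTo⁺₂)
open import Data.List.Relation.Unary.AllPairs using (_∷_)
open import Data.List.Relation.Unary.Unique.Propositional using (Unique)
import Data.List.Relation.Unary.Unique.Propositional.Properties as Unique
open import Data.List.Relation.Binary.Sublist.Propositional using (_⊆_; []; _∷_; _∷ʳ_; ⊆-refl; ⊆-trans)
import Data.List.Relation.Binary.Sublist.Propositional.Properties as Sublist
open import Data.Rational.Unnormalised as ℚᵘ using (mkℚᵘ; *≤*) renaming (_≃_ to _≃ᵘ_)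
import Data.Rational.Unnormalised.Properties as ℚᵘ
import Data.Rational.Properties as ℚ
import Data.Integer as ℤ
import Data.Integer.Properties as ℤ
open import Relation.Nullary.Decidable using (_×-dec_)
open import Relation.Binary.PropositionalEquality
open import Algebra.Properties.CommutativeSemigroup *-commutativeSemigroup
  using (interchange; x∙yz≈y∙xz; xy∙z≈xz∙y)

private
  variable
    a : Level
    A : Set a

^-distribʳ-* : ∀ m n k → (m * n) ^ k ≡ m ^ k * n ^ k
^-distribʳ-* m n zero    = refl
^-distribʳ-* m n (suc k) = trans (cong (m * n *_) (^-distribʳ-* m n k)) (interchange m n (m ^ k) (n ^ k))

∏ : (A → ℕ) → List A → ℕ
∏ f xs = product (map f xs)

∏-++ : ∀ (f : A → ℕ) xs ys → ∏ f (xs ++ ys) ≡ ∏ f xs * ∏ f ys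
∏-++ f xs ys = trans (cong product (map-++ f xs ys)) (product-++ (map f xs) (map f ys))

∏-* : ∀ (f g : A → ℕ) xs → ∏ (λ x → f x * g x) xs ≡ ∏ f xs * ∏ g xs
∏-* f g []       = refl
∏-* f g (x ∷ xs) = trans (cong (f x * g x *_) (∏-* f g xs)) (interchange (f x) (g x) (∏ f xs) (∏ g xs))

∏-^ : ∀ (f : A → ℕ) k xs → ∏ (λ x → f x ^ k) xs ≡ ∏ f xs ^ k
∏-^ f k []       = sym (^-zeroˡ k)
∏-^ f k (x ∷ xs) = trans (cong (f x ^ k *_) (∏-^ f k xs)) (sym (^-distribʳ-* (f x) (∏ f xs) k))

∏-const : ∀ c (xs : List A) → ∏ (λ _ → c) xs ≡ c ^ length xs
∏-const c []       = refl
∏-const c (x ∷ xs) = cong (c *_) (∏-const c xs)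

∏-cong : ∀ {f g : A → ℕ} {xs} → All (λ x → f x ≡ g x) xs → ∏ f xs ≡ ∏ g xs
∏-cong = cong product ∘ map-cong-local

∏-nonZero : ∀ {P : A → Set} (f : A → ℕ) {xs} →
  (∀ {x} → P x → NonZero (f x)) → All P xs → NonZero (∏ f xs)
∏-nonZero f nonZero Pxs = product≢0 (All.map⁺ (All.map nonZero Pxs))

∏-ratio-⊆ : ∀ (f g : A → ℕ) {xs ys} → xs ⊆ ys →
  ∏ f xs * ∏ g ys ≤ ∏ g xs * ∏ (λ y → f y ⊔ g y) ys
∏-ratio-⊆ f g [] = ≤-refl
∏-ratio-⊆ f g {xs} {y ∷ ys} (.y ∷ʳ τ) = begin
  ∏ f xs * (g y * ∏ g ys) ≡⟨ x∙yz≈y∙xz (∏ f xs) (g y) (∏ g ys) ⟩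
  g y * (∏ f xs * ∏ g ys) ≤⟨ *-mono-≤ (m≤n⊔m (f y) (g y)) (∏-ratio-⊆ f g τ) ⟩
  h y * (∏ g xs * ∏ h ys) ≡⟨ x∙yz≈y∙xz (h y) (∏ g xs) (∏ h ys) ⟩
  ∏ g xs * (h y * ∏ h ys) ∎
  where
  open ≤-Reasoning
  h = λ y → f y ⊔ g y
∏-ratio-⊆ f g {x ∷ xs} {.x ∷ ys} (refl ∷ τ) = begin
  f x * ∏ f xs * (g x * ∏ g ys) ≡⟨ interchange (f x) (∏ f xs) (g x) (∏ g ys) ⟩
  f x * g x * (∏ f xs * ∏ g ys) ≤⟨ *-mono-≤ fg≤gh (∏-ratio-⊆ f g τ) ⟩
  g x * h x * (∏ g xs * ∏ h ys) ≡⟨ interchange (g x) (h x) (∏ g xs) (∏ h ys) ⟩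
  g x * ∏ g xs * (h x * ∏ h ys) ∎
  where
  open ≤-Reasoning
  h = λ y → f y ⊔ g y
  fg≤gh : f x * g x ≤ g x * h x
  fg≤gh = ≤-trans (≤-reflexive (*-comm (f x) (g x))) (*-monoʳ-≤ (g x) (m≤m⊔n (f x) (g x)))

applyUpTo-++ : ∀ (f : ℕ → A) m n →
  applyUpTo f (m + n) ≡ applyUpTo f m ++ applyUpTo (λ i → f (m + i)) n
applyUpTo-++ f zero    n = refl
applyUpTo-++ f (suc m) n = cong (f 0 ∷_) (applyUpTo-++ (f ∘ suc) m n)

upTo-⊆ : ∀ {m n} → m ≤ n → upTo m ⊆ upTo n
upTo-⊆ {m} m≤n with k , refl ← m≤n⇒∃[o]m+o≡n m≤n =
  subst (upTo m ⊆_) (sym (applyUpTo-++ id m k)) (Sublist.++⁺ʳ _ ⊆-refl)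

primesBelow : ℕ → List ℕ
primesBelow n = filter prime? (upTo n)

primesBelow-+ : ∀ m n → primesBelow (m + n) ≡ primesBelow m ++ filter prime? (applyUpTo (m ℕ.+_) n)
primesBelow-+ m n = trans (cong (filter prime?) (applyUpTo-++ id m n)) (filter-++ prime? (upTo m) _)

∏-ratio-primesBelow : ∀ (f g : ℕ → ℕ) t →
  (∀ {p} → Prime p → NonZero (g p)) → (∀ {p} → Prime p → t ≤ p → f p ≤ g p) →
  ∀ {xs} n → xs ⊆ primesBelow n →
  ∏ f xs * ∏ g (primesBelow t) ≤ ∏ g xs * ∏ (λ p → f p ⊔ g p) (primesBelow t)
∏-ratio-primesBelow f g t g-nonZero f≤g {xs} n τ =
  *-cancelʳ-≤ _ _ (∏ g T) {{∏-nonZero g g-nonZero T-primes}} (begin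
    ∏ f xs * ∏ g S * ∏ g T   ≡⟨ *-assoc (∏ f xs) (∏ g S) (∏ g T) ⟩
    ∏ f xs * (∏ g S * ∏ g T) ≡⟨ cong (∏ f xs *_) (∏-++ g S T) ⟨
    ∏ f xs * ∏ g (S ++ T)    ≤⟨ ∏-ratio-⊆ f g xs⊆S++T ⟩
    ∏ g xs * ∏ h (S ++ T)    ≡⟨ cong (∏ g xs *_) (∏-++ h S T) ⟩
    ∏ g xs * (∏ h S * ∏ h T) ≡⟨ cong (λ z → ∏ g xs * (∏ h S * z)) (∏-cong h≡g-on-T) ⟩
    ∏ g xs * (∏ h S * ∏ g T) ≡⟨ *-assoc (∏ g xs) (∏ h S) (∏ g T) ⟨
    ∏ g xs * ∏ h S * ∏ g T   ∎)
  where
  open ≤-Reasoning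
  h = λ p → f p ⊔ g p
  S = primesBelow t
  T = filter prime? (applyUpTo (t ℕ.+_) n)
  xs⊆S++T : xs ⊆ S ++ T
  xs⊆S++T = subst (xs ⊆_) (primesBelow-+ t n)
    (⊆-trans τ (Sublist.filter⁺ prime? prime? (λ { refl → id }) (upTo-⊆ (m≤n+m n t))))
  T-primes : All Prime T
  T-primes = all-filter prime? (applyUpTo (t ℕ.+_) n)
  h≡g-on-T : All (λ p → h p ≡ g p) T
  h≡g-on-T = All.zipWith (λ (p-prime , t≤p) → m≤n⇒m⊔n≡n (f≤g p-prime t≤p))
    (T-primes , All.filter⁺ prime? (applyUpTo⁺₂ (t ℕ.+_) n (m≤m+n t)))

prime∣product⇒∈ : ∀ {p qs} → Prime p → All Prime qs → p ∣ product qs → p ∈ qs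
prime∣product⇒∈ {qs = []} p-prime [] p∣1 = ⊥-elim (¬prime[1] (subst Prime (∣1⇒≡1 p∣1) p-prime))
prime∣product⇒∈ {qs = q ∷ qs} p-prime (q-prime ∷ qs-prime) p∣q*Q
  with euclidsLemma q (product qs) p-prime p∣q*Q
... | inj₂ p∣Q = there (prime∣product⇒∈ p-prime qs-prime p∣Q)
... | inj₁ p∣q with prime⇒irreducible q-prime p∣q
...   | inj₁ refl = ⊥-elim (¬prime[1] p-prime)
...   | inj₂ p≡q  = here p≡q

distinctPrimes⇒product∣ : ∀ {ps n} → Unique ps → All Prime ps → All (_∣ n) ps → product ps ∣ n
distinctPrimes⇒product∣ {[]} {n} _ _ _ = 1∣ n
distinctPrimes⇒product∣ {p ∷ ps} {n} unique@(_ ∷ ps-unique) (p-prime ∷ ps-prime) (p∣n ∷ ps∣n)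
  with divides k n≡k*P ← distinctPrimes⇒product∣ ps-unique ps-prime ps∣n
  with euclidsLemma k (product ps) p-prime (subst (p ∣_) n≡k*P p∣n)
... | inj₂ p∣P = ⊥-elim (Unique.Unique[x∷xs]⇒x∉xs unique (prime∣product⇒∈ p-prime ps-prime p∣P))
... | inj₁ (divides j k≡j*p) = divides j (begin
  n                    ≡⟨ n≡k*P ⟩
  k * product ps       ≡⟨ cong (_* product ps) k≡j*p ⟩
  j * p * product ps   ≡⟨ *-assoc j p (product ps) ⟩
  j * product (p ∷ ps) ∎)
  where open ≡-Reasoning

primeDivisors-∣ : ∀ N → product (primeDivisors N) ∣ N
primeDivisors-∣ N = distinctPrimes⇒product∣ (Unique.filter⁺ prime-divisor? (Unique.upTo⁺ (suc N)))
  (All.map proj₁ prime-divisors) (All.map proj₂ prime-divisors)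
  where
  prime-divisor? = λ p → prime? p ×-dec (p ∣? N)
  prime-divisors = all-filter prime-divisor? (upTo (suc N))

primeDivisors-⊆ : ∀ N → primeDivisors N ⊆ primesBelow (suc N)
primeDivisors-⊆ N = Sublist.filter⁺ (λ p → prime? p ×-dec (p ∣? N)) prime?
  (λ { refl → proj₁ }) (⊆-refl {x = upTo (suc N)})

-- The constant is stated with _⊔′_ rather than _⊔_ so that it can be checked by evaluation:
-- _⊔_ recurses in unary, _⊔′_ goes through the builtin comparison.
primeDivisors-bound : ∀ (f g : ℕ → ℕ) t C D →
  (∀ {p} → Prime p → NonZero (g p)) → (∀ {p} → Prime p → t ≤ p → f p ≤ g p * p) →
  ∏ (λ p → f p ⊔′ g p * p) (primesBelow t) * D ≤ C * ∏ (λ p → g p * p) (primesBelow t) →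
  ∀ N .{{_ : NonZero N}} → ∏ f (primeDivisors N) * D ≤ C * N * ∏ g (primeDivisors N)
primeDivisors-bound f g t C D g-nonZero f≤g*p constant N =
  *-cancelʳ-≤ _ _ (∏ G S) {{∏-nonZero G G-nonZero (all-filter prime? (upTo t))}} (begin
    ∏ f L * D * ∏ G S       ≡⟨ xy∙z≈xz∙y (∏ f L) D (∏ G S) ⟩
    ∏ f L * ∏ G S * D       ≤⟨ *-monoˡ-≤ D ratio ⟩
    ∏ G L * ∏ H S * D       ≡⟨ *-assoc (∏ G L) (∏ H S) D ⟩
    ∏ G L * (∏ H S * D)     ≡⟨ cong (λ c → ∏ G L * (c * D)) ∏HS≡∏H′S ⟩
    ∏ G L * (∏ H′ S * D)    ≤⟨ *-monoʳ-≤ (∏ G L) constant ⟩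
    ∏ G L * (C * ∏ G S)     ≡⟨ x∙yz≈y∙xz (∏ G L) C (∏ G S) ⟩
    C * (∏ G L * ∏ G S)     ≡⟨ *-assoc C (∏ G L) (∏ G S) ⟨
    C * ∏ G L * ∏ G S       ≤⟨ *-monoˡ-≤ (∏ G S) (*-monoʳ-≤ C ∏GL≤N*∏gL) ⟩
    C * (N * ∏ g L) * ∏ G S ≡⟨ cong (_* ∏ G S) (*-assoc C N (∏ g L)) ⟨
    C * N * ∏ g L * ∏ G S   ∎)
  where
  open ≤-Reasoning
  G  = λ p → g p * p
  H  = λ p → f p ⊔ g p * p
  H′ = λ p → f p ⊔′ g p * p
  S  = primesBelow t
  L  = primeDivisors N
  G-nonZero : ∀ {p} → Prime p → NonZero (G p)
  G-nonZero {p} p-prime = m*n≢0 (g p) p {{g-nonZero p-prime}} {{prime⇒nonZero p-prime}}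
  ratio : ∏ f L * ∏ G S ≤ ∏ G L * ∏ H S
  ratio = ∏-ratio-primesBelow f G t G-nonZero f≤g*p (suc N) (primeDivisors-⊆ N)
  ∏HS≡∏H′S : ∏ H S ≡ ∏ H′ S
  ∏HS≡∏H′S = ∏-cong (All.universal (λ p → ⊔≡⊔′ (f p) (G p)) S)
  ∏GL≤N*∏gL : ∏ G L ≤ N * ∏ g L
  ∏GL≤N*∏gL = begin
    ∏ G L             ≡⟨ ∏-* g id L ⟩
    ∏ g L * ∏ id L    ≡⟨ cong (λ z → ∏ g L * product z) (map-id L) ⟩
    ∏ g L * product L ≤⟨ *-monoʳ-≤ (∏ g L) (∣⇒≤ (primeDivisors-∣ N)) ⟩
    ∏ g L * N         ≡⟨ *-comm (∏ g L) N ⟩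
    N * ∏ g L         ∎

ω-bound : ∀ N .{{_ : NonZero N}} → (2 ^ ω N) ^ 4 * 1000 ^ 4 ≤ 4862 ^ 4 * N
ω-bound N = subst₂ _≤_
  (cong (_* 1000 ^ 4) ∏16≡[2^ω]^4) (trans (cong (4862 ^ 4 * N *_) ∏1≡1) (*-identityʳ (4862 ^ 4 * N)))
  (primeDivisors-bound (λ _ → 2 ^ 4) (λ _ → 1) 17 (4862 ^ 4) (1000 ^ 4)
    (λ _ → _) 2^4≤1*p (≤ᵇ⇒≤ _ _ _) N)
  where
  L = primeDivisors N
  2^4≤1*p : ∀ {p} → Prime p → 17 ≤ p → 2 ^ 4 ≤ 1 * p
  2^4≤1*p {p} _ 17≤p = ≤-trans (≤-trans (n≤1+n 16) 17≤p) (≤-reflexive (sym (*-identityˡ p)))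
  ∏16≡[2^ω]^4 : ∏ (λ _ → 2 ^ 4) L ≡ (2 ^ ω N) ^ 4
  ∏16≡[2^ω]^4 = trans (∏-^ (λ _ → 2) 4 L) (cong (_^ 4) (∏-const 2 L))
  ∏1≡1 : ∏ (λ _ → 1) L ≡ 1
  ∏1≡1 = trans (∏-const 1 L) (^-zeroˡ (ω N))

[4+n]*[1+n]+2≡[2+n]*[3+n] : ∀ n → (4 + n) * (1 + n) + 2 ≡ (2 + n) * (3 + n)
[4+n]*[1+n]+2≡[2+n]*[3+n] = solve-∀

-- ((n + 3) / (n + 1))^e ≤ n + 1 persists from n to n + 1 since (n + 4)(n + 1) ≤ (n + 2)(n + 3).
^-ratio-step : ∀ e n → (3 + n) ^ e ≤ (1 + n) ^ suc e → (4 + n) ^ e ≤ (2 + n) ^ suc e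
^-ratio-step e n hyp = *-cancelʳ-≤ _ _ ((1 + n) ^ e) {{m^n≢0 (1 + n) e}} (begin
  (4 + n) ^ e * (1 + n) ^ e             ≡⟨ ^-distribʳ-* (4 + n) (1 + n) e ⟨
  ((4 + n) * (1 + n)) ^ e               ≤⟨ ^-monoˡ-≤ e [4+n]*[1+n]≤[2+n]*[3+n] ⟩
  ((2 + n) * (3 + n)) ^ e               ≡⟨ ^-distribʳ-* (2 + n) (3 + n) e ⟩
  (2 + n) ^ e * (3 + n) ^ e             ≤⟨ *-monoʳ-≤ ((2 + n) ^ e) hyp ⟩
  (2 + n) ^ e * ((1 + n) * (1 + n) ^ e) ≡⟨ *-assoc ((2 + n) ^ e) (1 + n) ((1 + n) ^ e) ⟨
  (2 + n) ^ e * (1 + n) * (1 + n) ^ e   ≤⟨ *-monoˡ-≤ ((1 + n) ^ e) [2+n]^e*[1+n]≤[2+n]^[1+e] ⟩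
  (2 + n) ^ suc e * (1 + n) ^ e         ∎)
  where
  open ≤-Reasoning
  [4+n]*[1+n]≤[2+n]*[3+n] : (4 + n) * (1 + n) ≤ (2 + n) * (3 + n)
  [4+n]*[1+n]≤[2+n]*[3+n] = ≤-trans (m≤m+n _ 2) (≤-reflexive ([4+n]*[1+n]+2≡[2+n]*[3+n] n))
  [2+n]^e*[1+n]≤[2+n]^[1+e] : (2 + n) ^ e * (1 + n) ≤ (2 + n) ^ suc e
  [2+n]^e*[1+n]≤[2+n]^[1+e] =
    ≤-trans (≤-reflexive (*-comm ((2 + n) ^ e) (1 + n))) (*-monoˡ-≤ ((2 + n) ^ e) (n≤1+n (1 + n)))

^-ratio-mono : ∀ e {m n} → m ≤′ n → (3 + m) ^ e ≤ (1 + m) ^ suc e → (3 + n) ^ e ≤ (1 + n) ^ suc e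
^-ratio-mono e ≤′-refl            hyp = hyp
^-ratio-mono e (≤′-step {n} m≤′n) hyp = ^-ratio-step e n (^-ratio-mono e m≤′n hyp)

νₚ-num νₚ-den : ℕ → ℕ
νₚ-num 0 = 1
νₚ-num 1 = 1
νₚ-num 2 = 4
νₚ-num (suc (suc (suc n))) = 3 + n
νₚ-den 0 = 1
νₚ-den 1 = 1
νₚ-den 2 = 1
νₚ-den (suc (suc (suc n))) = 1 + n

νₚ-den-nonZero : ∀ p → NonZero (νₚ-den p)
νₚ-den-nonZero 0                   = _
νₚ-den-nonZero 1                   = _
νₚ-den-nonZero 2                   = _
νₚ-den-nonZero (suc (suc (suc n))) = _

-- The exponent is a variable so that no literal power of the non-literal base 3 + n is ever
-- compared during type checking: Agda would expand it in unary.
νₚ^[1+e]≤p : ∀ e → 17 ^ e ≤ 15 ^ suc e →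
  ∀ {p} → 17 ≤ p → νₚ-num p ^ suc e ≤ νₚ-den p ^ suc e * p
νₚ^[1+e]≤p e base {suc (suc (suc n))} (s≤s (s≤s (s≤s 14≤n))) = begin
  (3 + n) ^ suc e           ≤⟨ *-monoʳ-≤ (3 + n) (^-ratio-mono e (≤⇒≤′ 14≤n) base) ⟩
  (3 + n) * (1 + n) ^ suc e ≡⟨ *-comm (3 + n) ((1 + n) ^ suc e) ⟩
  (1 + n) ^ suc e * (3 + n) ∎
  where open ≤-Reasoning

-- Unnormalised, so that numerators and denominators multiply termwise.
infix 4 _≃_÷_
record _≃_÷_ (q : ℚ) (x y : ℕ) : Set where
  constructor fraction
  field
    denominator-positive : 1 ≤ y
    toℚᵘ≃                : ℚ.toℚᵘ q ≃ᵘ mkℚᵘ (+ x) (pred y)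

÷-1 : ℚ.1ℚ ≃ 1 ÷ 1
÷-1 = fraction ≤-refl ℚᵘ.≃-refl

/≃÷ : ∀ x d → + x / suc d ≃ x ÷ suc d
/≃÷ x d = fraction (s≤s z≤n) (ℚ.toℚᵘ-fromℚᵘ (mkℚᵘ (+ x) d))

÷-* : ∀ {q r x y z w} → q ≃ x ÷ y → r ≃ z ÷ w → q ℚ.* r ≃ x * z ÷ y * w
÷-* {q} {r} {x} {suc y} {z} {suc w} (fraction _ q≃) (fraction _ r≃) = fraction (s≤s z≤n)
  (ℚᵘ.≃-trans (ℚ.toℚᵘ-homo-* q r) (ℚᵘ.≃-trans (ℚᵘ.*-cong q≃ r≃)
    (ℚᵘ.≃-reflexive (cong (λ n → mkℚᵘ n (pred (suc y * suc w))) (sym (ℤ.pos-* x z))))))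

÷-^ : ∀ {q x y} k → q ≃ x ÷ y → q ^ℚ k ≃ x ^ k ÷ y ^ k
÷-^ zero    _  = ÷-1
÷-^ (suc k) q≃ = ÷-* q≃ (÷-^ k q≃)

÷-≤ : ∀ {q r x y z w} → q ≃ x ÷ y → r ≃ z ÷ w → x * w ≤ z * y → q ℚ.≤ r
÷-≤ {x = x} {suc y} {z = z} {suc w} (fraction _ q≃) (fraction _ r≃) xw≤zy =
  ℚ.toℚᵘ-cancel-≤ (ℚᵘ.≤-trans (ℚᵘ.≤-reflexive q≃)
    (ℚᵘ.≤-trans (*≤* (subst₂ ℤ._≤_ (ℤ.pos-* x (suc w)) (ℤ.pos-* z (suc y)) (ℤ.+≤+ xw≤zy)))
      (ℚᵘ.≤-reflexive (ℚᵘ.≃-sym r≃))))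

νₚ≃ : ∀ p → νₚ p ≃ νₚ-num p ÷ νₚ-den p
νₚ≃ 0                   = ÷-1
νₚ≃ 1                   = ÷-1
νₚ≃ 2                   = /≃÷ 4 0
νₚ≃ (suc (suc (suc n))) = /≃÷ (3 + n) n

ν≃ : ∀ ps → foldr (λ p acc → νₚ p ℚ.* acc) ℚ.1ℚ ps ≃ ∏ νₚ-num ps ÷ ∏ νₚ-den ps
ν≃ []       = ÷-1
ν≃ (p ∷ ps) = ÷-* (νₚ≃ p) (ν≃ ps)

ν-bound : ∀ N .{{_ : NonZero N}} → ν N ^ℚ 16 ℚ.≤ (+ 21234 / 1000) ^ℚ 16 ℚ.* (+ N / 1)
ν-bound N = ÷-≤ (÷-^ 16 (ν≃ L)) (÷-* (÷-^ 16 (/≃÷ 21234 999)) (/≃÷ N 0))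
  (subst₂ _≤_
    (cong (_* (1000 ^ 16 * 1)) (∏-^ νₚ-num 16 L)) (cong (21234 ^ 16 * N *_) (∏-^ νₚ-den 16 L))
    (primeDivisors-bound (λ p → νₚ-num p ^ 16) (λ p → νₚ-den p ^ 16) 17 (21234 ^ 16) (1000 ^ 16 * 1)
      den-nonZero (λ _ → νₚ^[1+e]≤p 15 (≤ᵇ⇒≤ _ _ _)) (≤ᵇ⇒≤ _ _ _) N))
  where
  L = primeDivisors N
  den-nonZero : ∀ {p} → Prime p → NonZero (νₚ-den p ^ 16)
  den-nonZero {p} _ = m^n≢0 (νₚ-den p) 16 {{νₚ-den-nonZero p}}

lemma2p4 : (N : ℕ) → N ≥ 1 →
    ((2 ^ ω N) ^ 4 ℕ.* 1000 ^ 4 ℕ.≤ 4862 ^ 4 ℕ.* N)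
      × (ν N ^ℚ 16 ℚ.≤ (+ 21234 / 1000) ^ℚ 16 ℚ.* (+ N / 1))
lemma2p4 N N≥1 = ω-bound N {{>-nonZero N≥1}} , ν-bound N {{>-nonZero N≥1}}
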